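{- There is a $\lambda$-term $\mathtt{succ}$ of $\Lambda_{\tt det}$ such that for every term $k$ and every natural number $n$, $$\mathtt{succ}\, k\, \lceil \mathrm{bin}(n)\rceil \rightarrow_{det}^{O(\log n)} k\, \lceil \mathrm{bin}(n+1)\rceil.$$
   Context: $\Lambda_{\tt det}$: terms $t ::= v \mid t\,v$, values $v ::= \lambda x.t \mid x$; evaluation contexts $E ::= [\cdot] \mid E\,v$; reduction $E[(\lambda x.t)u] \rightarrow_{det} E[t\{x:=u\}]$. For $n\in\mathbb{N}$, $\mathrm{bin}(n)\in\{0,1\}^*$ is the reversed binary representation of $n$ (least significant bit first) with no trailing (rightmost) $0$s; thus $\mathrm{bin}(0)=\varepsilon$, $\mathrm{bin}(1)=1$, $\mathrm{bin}(2)=01$, $\mathrm{bin}(3)=11$, $\mathrm{bin}(4)=001$. Binary strings are Scott-encoded: $\lceil\varepsilon\rceil := \lambda x_0.\lambda x_1.\lambda x_\varepsilon.x_\varepsilon$, $\lceil 0 s\rceil := \lambda x_0.\lambda x_1.\lambda x_\varepsilon.x_0\lceil s\rceil$, $\lceil 1 s\rceil := \lambda x_0.\lambda x_1.\lambda x_\varepsilon.x_1\lceil s\rceil$. (Equivalently, the paper writes the target as $k\,\lceil \textsc{succ}(\mathrm{bin}(n))\rceil$ where $\textsc{succ}(\varepsilon)=1$, $\textsc{succ}(0s)=1s$, $\textsc{succ}(1s)=0\,\textsc{succ}(s)$, which satisfies $\textsc{succ}(\mathrm{bin}(n))=\mathrm{bin}(n+1)$.) -}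

module Defs where

open import Data.Nat using (ℕ; zero; suc; _+_; _*_; _≡ᵇ_; _%_; _/_)
open import Data.Bool using (Bool; true; false)
open import Data.List using (List; []; _∷_)

-- Λ_det syntax, de Bruijn indices (unscoped).
--   terms  t ::= v | t v      values v ::= λ.t | x
mutual
  data Tm : Set where
    val : Val → Tm
    app : Tm → Val → Tm

  data Val : Set where
    var : ℕ → Val
    lam : Tm → Val

ext : (ℕ → ℕ) → ℕ → ℕ
ext ρ zero    = zero
ext ρ (suc x) = suc (ρ x)

mutual
  renT : (ℕ → ℕ) → Tm → Tm
  renT ρ (val v)   = val (renV ρ v)
  renT ρ (app t v) = app (renT ρ t) (renV ρ v)

  renV : (ℕ → ℕ) → Val → Val
  renV ρ (var x) = var (ρ x)
  renV ρ (lam t) = lam (renT (ext ρ) t)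

exts : (ℕ → Val) → ℕ → Val
exts σ zero    = var zero
exts σ (suc x) = renV suc (σ x)

mutual
  subT : (ℕ → Val) → Tm → Tm
  subT σ (val v)   = val (subV σ v)
  subT σ (app t v) = app (subT σ t) (subV σ v)

  subV : (ℕ → Val) → Val → Val
  subV σ (var x) = σ x
  subV σ (lam t) = lam (subT (exts σ) t)

-- single substitution t{0 := u} (capture-avoiding, free variables of t above 0 shift down)
single : Val → ℕ → Val
single u zero    = u
single u (suc x) = var x

_[_] : Tm → Val → Tm
t [ u ] = subT (single u) t

infix 4 _→det_
data _→det_ : Tm → Tm → Set where
  β   : ∀ (t : Tm) (u : Val) → app (val (lam t)) u →det t [ u ]
  ctx : ∀ {t t′ : Tm} (v : Val) → t →det t′ → app t v →det app t′ v

data _→det^_⟨_⟩ : Tm → ℕ → Tm → Set where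
  done : ∀ {t} → t →det^ zero ⟨ t ⟩
  more : ∀ {t t′ t″ m} → t →det t′ → t′ →det^ m ⟨ t″ ⟩ → t →det^ suc m ⟨ t″ ⟩

-- bits: false = 0, true = 1
-- bin n : reversed binary representation (LSB first), no trailing 0s.
-- Fuel-based recursion (fuel n is always enough since n halves each step).
binAux : ℕ → ℕ → List Bool
binAux zero    m       = []
binAux (suc f) zero    = []
binAux (suc f) (suc m) = ((suc m % 2) ≡ᵇ 1) ∷ binAux f (suc m / 2)

bin : ℕ → List Bool
bin n = binAux n n

-- Scott encoding of binary strings (closed values):
--   ⌈ε⌉ = λx0.λx1.λxε.xε ; ⌈0s⌉ = λx0.λx1.λxε.x0⌈s⌉ ; ⌈1s⌉ = λx0.λx1.λxε.x1⌈s⌉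
⌈_⌉ : List Bool → Val
⌈ [] ⌉        = lam (val (lam (val (lam (val (var 0))))))
⌈ false ∷ s ⌉ = lam (val (lam (val (lam (app (val (var 2)) ⌈ s ⌉)))))
⌈ true ∷ s ⌉  = lam (val (lam (val (lam (app (val (var 1)) ⌈ s ⌉)))))

{-# OPTIONS --safe #-}
-- succ-term k ⌈s⌉ becomes loop loop ⌈s⌉ k, a recursion by self-application that
-- Scott-eliminates the least significant bit of s. On ε or a leading 0 the
-- incremented string is handed to k at once; on a leading 1 the loop recurses on
-- the tail with continuation prepend0, while k waits in the evaluation context
-- as an extra argument, to receive the 0 prepended to the incremented tail.
-- Each bit of the carry chain costs 9 steps, and bin n has at most ⌊log₂ n⌋ + 1 bits.
module Submission where

open import Defs
open import Data.Nat using (ℕ; zero; suc; _+_; _*_; _≤_; _<_; _≡ᵇ_; _%_; _/_; z≤n; s≤s; NonZero)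
open import Data.Nat.Properties
open import Data.Nat.DivMod using ([m+kn]%n≡m%n; m*n%n≡0; m*n/n≡m; +-distrib-/; m/n<m)
open import Data.Nat.Logarithm using (⌊log₂_⌋; ⌊log₂⌋-mono-≤; ⌊log₂[2*b]⌋≡1+⌊log₂b⌋)
open import Data.Nat.Tactic.RingSolver using (solve-∀)
open import Data.Bool using (Bool; true; false)
open import Data.List using (List; []; _∷_; length)
open import Data.Product using (Σ; _×_; _,_; proj₁; proj₂; ∃-syntax)
open import Function using (_∘_)
open import Relation.Binary.PropositionalEquality using (_≡_; refl; sym; trans; cong; cong₂; subst; module ≡-Reasoning)

mutual
  subT-cong : ∀ {σ τ} → (∀ x → σ x ≡ τ x) → ∀ t → subT σ t ≡ subT τ t
  subT-cong e (val v)   = cong val (subV-cong e v)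
  subT-cong e (app t v) = cong₂ app (subT-cong e t) (subV-cong e v)

  subV-cong : ∀ {σ τ} → (∀ x → σ x ≡ τ x) → ∀ v → subV σ v ≡ subV τ v
  subV-cong e (var x) = e x
  subV-cong e (lam t) = cong lam (subT-cong (exts-cong e) t)
    where
    exts-cong : ∀ {σ τ} → (∀ x → σ x ≡ τ x) → ∀ x → exts σ x ≡ exts τ x
    exts-cong e zero    = refl
    exts-cong e (suc x) = cong (renV suc) (e x)

mutual
  subT-renT : ∀ σ ρ t → subT σ (renT ρ t) ≡ subT (σ ∘ ρ) t
  subT-renT σ ρ (val v)   = cong val (subV-renV σ ρ v)
  subT-renT σ ρ (app t v) = cong₂ app (subT-renT σ ρ t) (subV-renV σ ρ v)

  subV-renV : ∀ σ ρ v → subV σ (renV ρ v) ≡ subV (σ ∘ ρ) v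
  subV-renV σ ρ (var x) = refl
  subV-renV σ ρ (lam t) =
    cong lam (trans (subT-renT (exts σ) (ext ρ) t) (subT-cong exts-ext t))
    where
    exts-ext : ∀ x → exts σ (ext ρ x) ≡ exts (σ ∘ ρ) x
    exts-ext zero    = refl
    exts-ext (suc x) = refl

mutual
  subT-id : ∀ t → subT var t ≡ t
  subT-id (val v)   = cong val (subV-id v)
  subT-id (app t v) = cong₂ app (subT-id t) (subV-id v)

  subV-id : ∀ v → subV var v ≡ v
  subV-id (var x) = refl
  subV-id (lam t) = cong lam (trans (subT-cong exts-var t) (subT-id t))
    where
    exts-var : ∀ x → exts var x ≡ var x
    exts-var zero    = refl
    exts-var (suc x) = refl

subV-single-weaken : ∀ u v → subV (single u) (renV suc v) ≡ v
subV-single-weaken u v =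
  trans (subV-renV (single u) suc v) (subV-id v)

Closed : Val → Set
Closed v = (∀ ρ → renV ρ v ≡ v) × (∀ σ → subV σ v ≡ v)

⌈⌉-closed : ∀ s → Closed ⌈ s ⌉
⌈⌉-closed s = ren s , sub s
  where
  ren : ∀ s ρ → renV ρ ⌈ s ⌉ ≡ ⌈ s ⌉
  ren []          ρ = refl
  ren (false ∷ s) ρ = cong (λ w → lam (val (lam (val (lam (app (val (var 2)) w)))))) (ren s _)
  ren (true ∷ s)  ρ = cong (λ w → lam (val (lam (val (lam (app (val (var 1)) w)))))) (ren s _)

  sub : ∀ s σ → subV σ ⌈ s ⌉ ≡ ⌈ s ⌉
  sub []          σ = refl
  sub (false ∷ s) σ = cong (λ w → lam (val (lam (val (lam (app (val (var 2)) w)))))) (sub s _)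
  sub (true ∷ s)  σ = cong (λ w → lam (val (lam (val (lam (app (val (var 1)) w)))))) (sub s _)

weaken^ : ℕ → Val → Val
weaken^ zero    v = v
weaken^ (suc n) v = renV suc (weaken^ n v)

weaken^-closed : ∀ {v} → Closed v → ∀ n → weaken^ n v ≡ v
weaken^-closed c zero    = refl
weaken^-closed c (suc n) = trans (cong (renV suc) (weaken^-closed c n)) (proj₁ c suc)

infixr 5 _◅_ _◅◅_

_◅_ : ∀ {t t′ t″ m} → t →det t′ → t′ →det^ m ⟨ t″ ⟩ → t →det^ suc m ⟨ t″ ⟩
_◅_ = more

_◅◅_ : ∀ {t t′ t″ m n} → t →det^ m ⟨ t′ ⟩ → t′ →det^ n ⟨ t″ ⟩ → t →det^ m + n ⟨ t″ ⟩
done     ◅◅ r′ = r′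
more s r ◅◅ r′ = s ◅ (r ◅◅ r′)

ctx⋆ : ∀ {t t′ m} v → t →det^ m ⟨ t′ ⟩ → app t v →det^ m ⟨ app t′ v ⟩
ctx⋆ v done       = done
ctx⋆ v (more s r) = ctx v s ◅ ctx⋆ v r

↠-cast : ∀ {t t′ m n} → m ≡ n → t →det^ m ⟨ t′ ⟩ → t →det^ n ⟨ t′ ⟩
↠-cast refl r = r

β≡ : ∀ {t u t′} → t [ u ] ≡ t′ → app (val (lam t)) u →det t′
β≡ refl = β _ _

⌈ε⌉-elim : ∀ a b c → app (app (app (val ⌈ [] ⌉) a) b) c →det^ 3 ⟨ val c ⟩
⌈ε⌉-elim a b c = ctx c (ctx b (β _ a)) ◅ ctx c (β _ b) ◅ β _ c ◅ done

⌈0∷⌉-elim : ∀ {a} → Closed a → ∀ b c s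
          → app (app (app (val ⌈ false ∷ s ⌉) a) b) c →det^ 3 ⟨ app (val a) ⌈ s ⌉ ⟩
⌈0∷⌉-elim {a} a-closed b c s =
  ctx c (ctx b (β≡ (cong (λ w → val (lam (val (lam w))))
                         (fixed (weaken^-closed a-closed 2))))) ◅
  ctx c (β≡ (cong (val ∘ lam) (fixed (proj₂ a-closed _)))) ◅
  β≡ (fixed (proj₂ a-closed _)) ◅ done
  where
  fixed : ∀ {σ v} → v ≡ a → app (val v) (subV σ ⌈ s ⌉) ≡ app (val a) ⌈ s ⌉
  fixed v≡a = cong₂ (app ∘ val) v≡a (proj₂ (⌈⌉-closed s) _)

⌈1∷⌉-elim : ∀ a b c s → app (app (app (val ⌈ true ∷ s ⌉) a) b) c →det^ 3 ⟨ app (val b) ⌈ s ⌉ ⟩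
⌈1∷⌉-elim a b c s =
  ctx c (ctx b (β≡ (cong (λ w → val (lam (val (lam (app (val (var 1)) w))))) (closed _)))) ◅
  ctx c (β≡ (cong (λ w → val (lam (app (val (renV suc b)) w))) (closed _))) ◅
  β≡ (cong₂ (app ∘ val) (subV-single-weaken c b) (closed _)) ◅ done
  where
  closed : ∀ σ → subV σ ⌈ s ⌉ ≡ ⌈ s ⌉
  closed = proj₂ (⌈⌉-closed s)

-- λr.λk. k ⌈0r⌉
prepend0 : Val
prepend0 = lam (val (lam (app (val (var 0)) (lam (val (lam (val (lam (app (val (var 2)) (var 4))))))))))

-- λs.λf.λk. k ⌈1s⌉
case0 : Val
case0 = lam (val (lam (val (lam (app (val (var 0)) (lam (val (lam (val (lam (app (val (var 1)) (var 5))))))))))))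

-- λs.λf. f f s prepend0
case1 : Val
case1 = lam (val (lam (app (app (app (val (var 0)) (var 0)) (var 1)) prepend0)))

-- λf.λk. k ⌈1⌉
caseε : Val
caseε = lam (val (lam (app (val (var 0)) ⌈ true ∷ [] ⌉)))

-- λf.λs. s case0 case1 caseε f
loop : Val
loop = lam (val (lam (app (app (app (app (val (var 0)) case0) case1) caseε) (var 1))))

-- λk.λs. loop loop s k
succ-term : Val
succ-term = lam (val (lam (app (app (app (val loop) loop) (var 0)) (var 1))))

case0-closed : Closed case0
case0-closed = (λ _ → refl) , (λ _ → refl)

prepend0-↠ : ∀ s k → app (app (val prepend0) ⌈ s ⌉) k →det^ 2 ⟨ app (val k) ⌈ false ∷ s ⌉ ⟩
prepend0-↠ s k =
  ctx k (β≡ (cong (λ w → val (lam (app (val (var 0)) (lam (val (lam (val (lam (app (val (var 2)) w)))))))))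
                  (weaken^-closed (⌈⌉-closed s) 4))) ◅
  β≡ (cong (app (val k)) (proj₂ (⌈⌉-closed (false ∷ s)) _)) ◅ done

case0-↠ : ∀ s f k → app (app (app (val case0) ⌈ s ⌉) f) k →det^ 3 ⟨ app (val k) ⌈ true ∷ s ⌉ ⟩
case0-↠ s f k =
  ctx k (ctx f (β≡ (cong (λ w → val (lam (val (lam (app (val (var 0)) (lam (val (lam (val (lam (app (val (var 1)) w)))))))))))
                         (weaken^-closed (⌈⌉-closed s) 5)))) ◅
  ctx k (β≡ (cong (λ w → val (lam (app (val (var 0)) w))) (closed _))) ◅
  β≡ (cong (app (val k)) (closed _)) ◅ done
  where
  closed : ∀ σ → subV σ ⌈ true ∷ s ⌉ ≡ ⌈ true ∷ s ⌉
  closed = proj₂ (⌈⌉-closed (true ∷ s))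

case1-↠ : ∀ s f → app (app (val case1) ⌈ s ⌉) f →det^ 2 ⟨ app (app (app (val f) f) ⌈ s ⌉) prepend0 ⟩
case1-↠ s f =
  ctx f (β≡ (cong (λ w → val (lam (app (app (app (val (var 0)) (var 0)) w) prepend0)))
                  (weaken^-closed (⌈⌉-closed s) 1))) ◅
  β≡ (cong (λ w → app (app (app (val f) f) w) prepend0) (proj₂ (⌈⌉-closed s) _)) ◅ done

caseε-↠ : ∀ f k → app (app (val caseε) f) k →det^ 2 ⟨ app (val k) ⌈ true ∷ [] ⌉ ⟩
caseε-↠ f k = ctx k (β _ f) ◅ β _ k ◅ done

loop-unfold : ∀ s k → app (app (app (val loop) loop) ⌈ s ⌉) k
                      →det^ 2 ⟨ app (app (app (app (app (val ⌈ s ⌉) case0) case1) caseε) loop) k ⟩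
loop-unfold s k =
  ctx k (ctx ⌈ s ⌉ (β _ loop)) ◅
  ctx k (β _ ⌈ s ⌉) ◅ done

succ-unfold : ∀ k s → app (app (val succ-term) k) ⌈ s ⌉ →det^ 2 ⟨ app (app (app (val loop) loop) ⌈ s ⌉) k ⟩
succ-unfold k s = ctx ⌈ s ⌉ (β _ k) ◅ β≡ (cong (app _) (subV-single-weaken ⌈ s ⌉ k)) ◅ done

incr : List Bool → List Bool
incr []          = true ∷ []
incr (false ∷ s) = true ∷ s
incr (true ∷ s)  = false ∷ incr s

loop-steps : List Bool → ℕ
loop-steps []          = 7
loop-steps (false ∷ s) = 8
loop-steps (true ∷ s)  = 9 + loop-steps s

loop-↠ : ∀ s k → app (app (app (val loop) loop) ⌈ s ⌉) k →det^ loop-steps s ⟨ app (val k) ⌈ incr s ⌉ ⟩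
loop-↠ [] k =
  loop-unfold [] k ◅◅ ctx⋆ k (ctx⋆ loop (⌈ε⌉-elim case0 case1 caseε)) ◅◅ caseε-↠ loop k
loop-↠ (false ∷ s) k =
  loop-unfold (false ∷ s) k ◅◅
  ctx⋆ k (ctx⋆ loop (⌈0∷⌉-elim case0-closed case1 caseε s)) ◅◅
  case0-↠ s loop k
loop-↠ (true ∷ s) k = ↠-cast (cong (7 +_) (+-comm (loop-steps s) 2)) (
  loop-unfold (true ∷ s) k ◅◅
  ctx⋆ k (ctx⋆ loop (⌈1∷⌉-elim case0 case1 caseε s)) ◅◅
  ctx⋆ k (case1-↠ s loop) ◅◅
  ctx⋆ k (loop-↠ s prepend0) ◅◅
  prepend0-↠ (incr s) k)

succ-↠ : ∀ k s → app (app (val succ-term) k) ⌈ s ⌉ →det^ 2 + loop-steps s ⟨ app (val k) ⌈ incr s ⌉ ⟩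
succ-↠ k s = succ-unfold k s ◅◅ loop-↠ s k

suc-/2≤ : ∀ m → suc m / 2 ≤ m
suc-/2≤ m = m<1+n⇒m≤n (m/n<m (suc m) 2 ≤-refl)

binAux-fuel : ∀ {f g} m → m ≤ f → m ≤ g → binAux f m ≡ binAux g m
binAux-fuel {zero}  {zero}  zero _ _ = refl
binAux-fuel {zero}  {suc g} zero _ _ = refl
binAux-fuel {suc f} {zero}  zero _ _ = refl
binAux-fuel {suc f} {suc g} zero _ _ = refl
binAux-fuel {suc f} {suc g} (suc m) (s≤s m≤f) (s≤s m≤g) =
  cong (_ ∷_) (binAux-fuel (suc m / 2) (≤-trans (suc-/2≤ m) m≤f) (≤-trans (suc-/2≤ m) m≤g))

bin-suc : ∀ m → bin (suc m) ≡ (suc m % 2 ≡ᵇ 1) ∷ bin (suc m / 2)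
bin-suc m = cong ((suc m % 2 ≡ᵇ 1) ∷_) (binAux-fuel (suc m / 2) (suc-/2≤ m) ≤-refl)

bin-odd : ∀ q → bin (1 + q * 2) ≡ true ∷ bin q
bin-odd q = trans (bin-suc (q * 2)) (cong₂ _∷_ (cong (_≡ᵇ 1) ([m+kn]%n≡m%n 1 q 2)) (cong bin half))
  where
  half : (1 + q * 2) / 2 ≡ q
  half = trans (+-distrib-/ 1 (q * 2) (subst (λ r → 1 + r < 2) (sym (m*n%n≡0 q 2)) ≤-refl))
               (m*n/n≡m q 2)

bin-even : ∀ q → bin (suc q * 2) ≡ false ∷ bin (suc q)
bin-even q = trans (bin-suc (suc (q * 2)))
                   (cong₂ _∷_ (cong (_≡ᵇ 1) (m*n%n≡0 (suc q) 2)) (cong bin (m*n/n≡m (suc q) 2)))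

-- n is 0, 1 + 2q or 2 + 2q; built by counting up, so no well-founded recursion is needed.
data Halving : ℕ → Set where
  zero : Halving 0
  odd  : ∀ {q} → Halving q → Halving (1 + q * 2)
  even : ∀ {q} → Halving (suc q) → Halving (suc q * 2)

halving-suc : ∀ {n} → Halving n → Halving (suc n)
halving-suc zero     = odd zero
halving-suc (odd h)  = even (halving-suc h)
halving-suc (even h) = odd h

halving : ∀ n → Halving n
halving zero    = zero
halving (suc n) = halving-suc (halving n)

incr-bin : ∀ {n} → Halving n → incr (bin n) ≡ bin (suc n)
incr-bin zero = refl
incr-bin (odd {q} h) = begin
  incr (bin (1 + q * 2))  ≡⟨ cong incr (bin-odd q) ⟩
  false ∷ incr (bin q)    ≡⟨ cong (false ∷_) (incr-bin h) ⟩
  false ∷ bin (suc q)     ≡⟨ bin-even q ⟨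
  bin (suc q * 2)         ∎
  where open ≡-Reasoning
incr-bin (even {q} h) = begin
  incr (bin (suc q * 2))  ≡⟨ cong incr (bin-even q) ⟩
  true ∷ bin (suc q)      ≡⟨ bin-odd (suc q) ⟨
  bin (1 + suc q * 2)     ∎
  where open ≡-Reasoning

⌊log₂[n*2]⌋≡1+⌊log₂n⌋ : ∀ n .{{_ : NonZero n}} → ⌊log₂ (n * 2) ⌋ ≡ suc ⌊log₂ n ⌋
⌊log₂[n*2]⌋≡1+⌊log₂n⌋ n = trans (cong ⌊log₂_⌋ (*-comm n 2)) (⌊log₂[2*b]⌋≡1+⌊log₂b⌋ n)

length-bin≤⌊log₂[n*2]⌋ : ∀ {n} → Halving n → length (bin n) ≤ ⌊log₂ (n * 2) ⌋
length-bin≤⌊log₂[n*2]⌋ zero = z≤n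
length-bin≤⌊log₂[n*2]⌋ (odd {q} h) = begin
  length (bin (1 + q * 2))     ≡⟨ cong length (bin-odd q) ⟩
  suc (length (bin q))         ≤⟨ s≤s (length-bin≤⌊log₂[n*2]⌋ h) ⟩
  suc ⌊log₂ (q * 2) ⌋          ≤⟨ s≤s (⌊log₂⌋-mono-≤ (n≤1+n (q * 2))) ⟩
  suc ⌊log₂ (1 + q * 2) ⌋      ≡⟨ ⌊log₂[n*2]⌋≡1+⌊log₂n⌋ (1 + q * 2) ⟨
  ⌊log₂ ((1 + q * 2) * 2) ⌋    ∎
  where open ≤-Reasoning
length-bin≤⌊log₂[n*2]⌋ (even {q} h) = begin
  length (bin (suc q * 2))     ≡⟨ cong length (bin-even q) ⟩
  suc (length (bin (suc q)))   ≤⟨ s≤s (length-bin≤⌊log₂[n*2]⌋ h) ⟩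
  suc ⌊log₂ (suc q * 2) ⌋      ≡⟨ ⌊log₂[n*2]⌋≡1+⌊log₂n⌋ (suc q * 2) ⟨
  ⌊log₂ (suc q * 2 * 2) ⌋      ∎
  where open ≤-Reasoning

length-bin≤ : ∀ n → length (bin n) ≤ suc ⌊log₂ n ⌋
length-bin≤ zero    = z≤n
length-bin≤ (suc n) = ≤-trans (length-bin≤⌊log₂[n*2]⌋ (halving (suc n)))
                              (≤-reflexive (⌊log₂[n*2]⌋≡1+⌊log₂n⌋ (suc n)))

loop-steps≤ : ∀ s → loop-steps s ≤ 9 * length s + 8
loop-steps≤ []          = m≤n+m 7 1
loop-steps≤ (false ∷ s) = m≤n+m 8 (9 * suc (length s))
loop-steps≤ (true ∷ s)  = begin
  9 + loop-steps s            ≤⟨ +-monoʳ-≤ 9 (loop-steps≤ s) ⟩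
  9 + (9 * length s + 8)      ≡⟨ +-assoc 9 (9 * length s) 8 ⟨
  9 + 9 * length s + 8        ≡⟨ cong (_+ 8) (*-suc 9 (length s)) ⟨
  9 * suc (length s) + 8      ∎
  where open ≤-Reasoning

succ-steps≤ : ∀ n → 2 + loop-steps (bin n) ≤ 9 * ⌊log₂ n ⌋ + 19
succ-steps≤ n = begin
  2 + loop-steps (bin n)         ≤⟨ +-monoʳ-≤ 2 (loop-steps≤ (bin n)) ⟩
  2 + (9 * length (bin n) + 8)   ≤⟨ +-monoʳ-≤ 2 (+-monoˡ-≤ 8 (*-monoʳ-≤ 9 (length-bin≤ n))) ⟩
  2 + (9 * suc ⌊log₂ n ⌋ + 8)    ≡⟨ arithmetic ⌊log₂ n ⌋ ⟩
  9 * ⌊log₂ n ⌋ + 19             ∎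
  where
  open ≤-Reasoning
  arithmetic : ∀ l → 2 + (9 * suc l + 8) ≡ 9 * l + 19
  arithmetic = solve-∀

mainTheorem3 : Σ Val λ succ → ∃[ c ] ∃[ d ] ((k : Val) (n : ℕ) →
      ∃[ m ] ((m ≤ c * ⌊log₂ n ⌋ + d)
        × (app (app (val succ) k) ⌈ bin n ⌉ →det^ m ⟨ app (val k) ⌈ bin (n + 1) ⌉ ⟩)))
mainTheorem3 = succ-term , 9 , 19 , λ k n →
  2 + loop-steps (bin n) , succ-steps≤ n ,
  subst (λ s → app (app (val succ-term) k) ⌈ bin n ⌉ →det^ 2 + loop-steps (bin n) ⟨ app (val k) ⌈ s ⌉ ⟩)
        (trans (incr-bin (halving n)) (cong bin (+-comm 1 n)))
        (succ-↠ k (bin n))
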